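{- Let $n\geq 4$ and let $G$ be a simple bipartite graph with bipartition $(X,Y)$, where $|X|=|Y|=n$, with minimum degree $\delta(G)\geq 2$ and with $m$ edges. If $m\geq n^{2}-2n+4$, then $G$ is Hamiltonian unless $G\cong K_{n,n-2}+4e$.
   Context: A graph is Hamiltonian if it contains a cycle passing through all its vertices. For $p\geq n-1$, $K_{p,n-2}+4e$ denotes the bipartite graph obtained from the complete bipartite graph $K_{p,n-2}$ by adding two new vertices, each of which is joined to the same two vertices of degree $n-2$ of $K_{p,n-2}$ (i.e. to the same two vertices of the part of size $p$); it has $4$ more edges than $K_{p,n-2}$. -}

module Defs where

open import Data.Nat using (ℕ; zero; suc; _+_; _*_; _∸_; _<_; _≤_)
open import Data.Fin using (Fin; toℕ)
import Data.Fin as F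
open import Data.Bool using (Bool; true; false; T; if_then_else_)
open import Data.Sum using (_⊎_; inj₁; inj₂)
open import Data.Product using (Σ; _×_; _,_)
open import Data.Empty using (⊥)
open import Relation.Binary.PropositionalEquality using (_≡_)
open import Function.Bundles using (_↔_; _⇔_; Inverse)

sumF : ∀ {n} → (Fin n → ℕ) → ℕ
sumF {zero}  f = 0
sumF {suc n} f = f F.zero + sumF (λ i → f (F.suc i))

countF : ∀ {n} → (Fin n → Bool) → ℕ
countF p = sumF (λ i → if p i then 1 else 0)

-- A (simple) bipartite graph with parts X = Fin n and Y = Fin n is given
-- by its bipartite adjacency relation  E x y  (x ∈ X, y ∈ Y).
BipGraph : ℕ → Set
BipGraph n = Fin n → Fin n → Bool

Vtx : ℕ → Set
Vtx n = Fin n ⊎ Fin n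

Adj : ∀ {n} → BipGraph n → Vtx n → Vtx n → Set
Adj E (inj₁ x) (inj₂ y) = T (E x y)
Adj E (inj₂ y) (inj₁ x) = T (E x y)
Adj E (inj₁ _) (inj₁ _) = ⊥
Adj E (inj₂ _) (inj₂ _) = ⊥

degX : ∀ {n} → BipGraph n → Fin n → ℕ
degX E x = countF (λ y → E x y)

degY : ∀ {n} → BipGraph n → Fin n → ℕ
degY E y = countF (λ x → E x y)

MinDeg≥2 : ∀ {n} → BipGraph n → Set
MinDeg≥2 E = (∀ x → 2 ≤ degX E x) × (∀ y → 2 ≤ degY E y)

edges : ∀ {n} → BipGraph n → ℕ
edges E = sumF (λ x → degX E x)

CycNext : (k : ℕ) → Fin k → Fin k → Set
CycNext k i j = (suc (toℕ i) ≡ toℕ j) ⊎ ((suc (toℕ i) ≡ k) × (toℕ j ≡ 0))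

-- Hamiltonian: there is a cycle v_0 v_1 ... v_{k-1} v_0 (k ≥ 3) visiting
-- every vertex exactly once (the enumeration is a bijection Fin k ↔ V).
Hamiltonian : ∀ {n} → BipGraph n → Set
Hamiltonian {n} E =
  Σ ℕ λ k → (3 ≤ k) × Σ (Fin k ↔ Vtx n) λ c →
    ∀ i j → CycNext k i j → Adj E (Inverse.to c i) (Inverse.to c j)

_≅_ : ∀ {n} → BipGraph n → BipGraph n → Set
_≅_ {n} E E' = Σ (Vtx n ↔ Vtx n) λ φ →
  ∀ u v → Adj E u v ⇔ Adj E' (Inverse.to φ u) (Inverse.to φ v)

-- K_{n,n-2}+4e (here p = n):  part X of size n; in part Y the vertices
-- 0..n-3 are joined to every vertex of X (forming K_{n,n-2}), and the two
-- extra vertices n-2, n-1 of Y are each joined to the same two vertices 0,1 of X.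
Kplus4e : (n : ℕ) → BipGraph n
Kplus4e n x y with toℕ y Data.Nat.<ᵇ (n ∸ 2)
... | true  = true
... | false = toℕ x Data.Nat.<ᵇ 2

-- Work with non-edges: G has at most 2n − 4 of them, and every vertex misses at most n − 2
-- vertices of the other side. By Pósa's crossing argument a Hamiltonian path between x and y
-- with deg x + deg y ≥ n + 1 closes into a Hamiltonian cycle, so adding such a non-edge xy
-- does not change Hamiltonicity (the bipartite Bondy–Chvátal closure). Adding these edges
-- one at a time either completes the graph, which is Hamiltonian, or stops at a closed graph
-- with at least one non-edge. There, let v be a vertex of least positive co-degree d: each of
-- its d non-neighbours has co-degree at least max(d, n − d), so d · max(d, n − d) ≤ 2n − 4.
-- This rules out d = 1 and d ≥ 3, and d = 2 forces two vertices of degree 2 with a common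
-- neighbourhood and everything else complete, i.e. K_{n,n−2}+4e, which has exactly 2n − 4
-- non-edges and hence can only be the original graph.

module Submission where

open import Defs
open import Data.Nat using (ℕ; zero; suc; _+_; _*_; _∸_; _≤_; _<_; z≤n; s≤s; _<?_; _≤?_; _<ᵇ_; _⊔_)
open import Data.Nat.Properties
open import Relation.Binary.Definitions using (tri<; tri≈; tri>)
open import Data.Nat.Tactic.RingSolver using (solve-∀)
open import Data.Fin as F using (Fin; toℕ; fromℕ; fromℕ<; inject₁)
open import Data.Fin.Relation.Unary.Top using (View; view; ‵fromℕ; ‵inject₁; view-fromℕ; view-inject₁)
import Data.Fin.Properties as FP
open import Data.Fin.Permutation as Perm using (Permutation′; _⟨$⟩ʳ_; _⟨$⟩ˡ_; _∘ₚ_)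
open import Data.Bool as Bool using (Bool; true; false; T; not; if_then_else_; _∧_; _∨_)
open import Data.Product as Product using (Σ; _×_; _,_; proj₁; proj₂; ∃; uncurry)
open import Data.Sum using (_⊎_; inj₁; inj₂; swap; [_,_]′)
open import Data.Sum.Properties using (swap-↔)
open import Data.Sum.Function.Propositional using (_⊎-↔_)
open import Data.Empty using (⊥; ⊥-elim)
open import Data.Unit using (tt)
open import Data.Vec.Functional using (updateAt)
open import Data.Vec.Functional.Properties using (updateAt-updates; updateAt-minimal)
open import Function.Base using (_∘_; const; id)
open import Function.Bundles using (Equivalence; Injection; Inverse; _↔_; mk↔ₛ′; _⇔_; mk⇔)
open import Function.Construct.Composition using (_↔-∘_; _⇔-∘_)
open import Function.Properties.Inverse using (↔⇒↣)
open import Data.Bool.Properties using (T-∧; T-∨; T-≡; T-not-≡; ∨-zeroʳ; ∨-identityʳ; ∧-zeroʳ; not-injective)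
open import Relation.Binary.PropositionalEquality
open import Relation.Nullary using (¬_; Dec; yes; no; ¬?; does)
open import Relation.Nullary.Decidable using (T?; _×-dec_; dec-true; dec-false)
import Algebra.Properties.CommutativeMonoid.Sum as MonoidSum
open import Algebra.Properties.CommutativeSemigroup +-commutativeSemigroup using (x∙yz≈y∙xz; interchange)

private
  module ∑ = MonoidSum +-0-commutativeMonoid

private variable
  n : ℕ

-- Sums and counts over Fin n

indicator : Bool → ℕ
indicator b = if b then 1 else 0

sumF≡sum : (f : Fin n → ℕ) → sumF f ≡ ∑.sum f
sumF≡sum {zero}  f = refl
sumF≡sum {suc n} f = cong (f F.zero +_) (sumF≡sum (f ∘ F.suc))

sumF-cong : {f g : Fin n → ℕ} → (∀ i → f i ≡ g i) → sumF f ≡ sumF g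
sumF-cong {zero}  f≗g = refl
sumF-cong {suc n} f≗g = cong₂ _+_ (f≗g F.zero) (sumF-cong (f≗g ∘ F.suc))

sumF-+ : (f g : Fin n → ℕ) → sumF (λ i → f i + g i) ≡ sumF f + sumF g
sumF-+ f g = begin
  sumF (λ i → f i + g i)   ≡⟨ sumF≡sum (λ i → f i + g i) ⟩
  ∑.sum (λ i → f i + g i)  ≡⟨ ∑.∑-distrib-+ f g ⟩
  ∑.sum f + ∑.sum g        ≡⟨ cong₂ _+_ (sumF≡sum f) (sumF≡sum g) ⟨
  sumF f + sumF g          ∎
  where open ≡-Reasoning

sumF-comm : ∀ {m} (f : Fin m → Fin n → ℕ) →
            sumF (λ i → sumF (f i)) ≡ sumF (λ j → sumF (λ i → f i j))
sumF-comm f = begin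
  sumF (λ i → sumF (f i))                   ≡⟨ sumF-cong (λ i → sumF≡sum (f i)) ⟩
  sumF (λ i → ∑.sum (f i))                  ≡⟨ sumF≡sum (λ i → ∑.sum (f i)) ⟩
  ∑.sum (λ i → ∑.sum (f i))                 ≡⟨ ∑.∑-comm f ⟩
  ∑.sum (λ j → ∑.sum (λ i → f i j))         ≡⟨ sumF≡sum (λ j → ∑.sum (λ i → f i j)) ⟨
  sumF (λ j → ∑.sum (λ i → f i j))          ≡⟨ sumF-cong (λ j → sumF≡sum (λ i → f i j)) ⟨
  sumF (λ j → sumF (λ i → f i j))           ∎
  where open ≡-Reasoning

sumF-permute : (f : Fin n → ℕ) (π : Permutation′ n) → sumF (f ∘ (π ⟨$⟩ʳ_)) ≡ sumF f
sumF-permute f π = begin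
  sumF (f ∘ (π ⟨$⟩ʳ_))    ≡⟨ sumF≡sum (f ∘ (π ⟨$⟩ʳ_)) ⟩
  ∑.sum (f ∘ (π ⟨$⟩ʳ_))   ≡⟨ ∑.∑-permute f π ⟨
  ∑.sum f                 ≡⟨ sumF≡sum f ⟨
  sumF f                  ∎
  where open ≡-Reasoning

sumF-const : (c : ℕ) → sumF {n} (const c) ≡ n * c
sumF-const {zero}  c = refl
sumF-const {suc n} c = cong (c +_) (sumF-const {n} c)

sumF-mono-≤ : {f g : Fin n → ℕ} → (∀ i → f i ≤ g i) → sumF f ≤ sumF g
sumF-mono-≤ {zero}  f≤g = z≤n
sumF-mono-≤ {suc n} f≤g = +-mono-≤ (f≤g F.zero) (sumF-mono-≤ (f≤g ∘ F.suc))

sumF≡0⇒≡0 : (f : Fin n → ℕ) → sumF f ≡ 0 → ∀ i → f i ≡ 0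
sumF≡0⇒≡0 f eq F.zero    = m+n≡0⇒m≡0 (f F.zero) eq
sumF≡0⇒≡0 f eq (F.suc i) = sumF≡0⇒≡0 (f ∘ F.suc) (m+n≡0⇒n≡0 (f F.zero) eq) i

sumF>0⇒∃>0 : (f : Fin n → ℕ) → 1 ≤ sumF f → ∃ λ i → 1 ≤ f i
sumF>0⇒∃>0 {suc n} f pos with f F.zero in eq
... | suc _ = F.zero , subst (1 ≤_) (sym eq) (s≤s z≤n)
... | zero  with sumF>0⇒∃>0 (f ∘ F.suc) pos
...   | i , fi>0 = F.suc i , fi>0

sumF-updateAt : (f : Fin n → ℕ) (i : Fin n) → sumF f ≡ f i + sumF (updateAt f i (const 0))
sumF-updateAt f F.zero    = refl
sumF-updateAt f (F.suc i) = begin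
  f F.zero + sumF (f ∘ F.suc)                                        ≡⟨ cong (f F.zero +_) (sumF-updateAt (f ∘ F.suc) i) ⟩
  f F.zero + (f (F.suc i) + sumF (updateAt (f ∘ F.suc) i (const 0))) ≡⟨ x∙yz≈y∙xz (f F.zero) (f (F.suc i)) _ ⟩
  f (F.suc i) + (f F.zero + sumF (updateAt (f ∘ F.suc) i (const 0))) ∎
  where open ≡-Reasoning

≤-sumF : (f : Fin n → ℕ) (i : Fin n) → f i ≤ sumF f
≤-sumF f i = ≤-trans (m≤m+n (f i) _) (≤-reflexive (sym (sumF-updateAt f i)))

≤-sumF₂ : (f : Fin n → ℕ) → ∀ {i j} → i ≢ j → f i + f j ≤ sumF f
≤-sumF₂ f {i} {j} i≢j = begin
  f i + f j                                 ≡⟨ cong (f i +_) (updateAt-minimal j i f (i≢j ∘ sym)) ⟨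
  f i + updateAt f i (const 0) j            ≤⟨ +-monoʳ-≤ (f i) (≤-sumF _ j) ⟩
  f i + sumF (updateAt f i (const 0))       ≡⟨ sumF-updateAt f i ⟨
  sumF f                                    ∎
  where open ≤-Reasoning

≤-sumF₃ : (f : Fin n → ℕ) → ∀ {i j k} → i ≢ j → i ≢ k → j ≢ k → f i + f j + f k ≤ sumF f
≤-sumF₃ f {i} {j} {k} i≢j i≢k j≢k = begin
  f i + f j + f k                           ≡⟨ +-assoc (f i) _ _ ⟩
  f i + (f j + f k)                         ≡⟨ cong (f i +_) (cong₂ _+_ (g≡f j i≢j) (g≡f k i≢k)) ⟨
  f i + (g j + g k)                         ≤⟨ +-monoʳ-≤ (f i) (≤-sumF₂ g j≢k) ⟩
  f i + sumF g                              ≡⟨ sumF-updateAt f i ⟨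
  sumF f                                    ∎
  where
  open ≤-Reasoning
  g = updateAt f i (const 0)
  g≡f : ∀ l → i ≢ l → g l ≡ f l
  g≡f l i≢l = updateAt-minimal l i f (i≢l ∘ sym)

countF-complement : (p : Fin n → Bool) → countF p + countF (not ∘ p) ≡ n
countF-complement {zero}  p = refl
countF-complement {suc n} p with p F.zero
... | true  = cong suc (countF-complement (p ∘ F.suc))
... | false = trans (+-suc _ _) (cong suc (countF-complement (p ∘ F.suc)))

indicator≤1 : ∀ b → indicator b ≤ 1
indicator≤1 true  = ≤-refl
indicator≤1 false = z≤n

indicator>0⇒T : ∀ b → 1 ≤ indicator b → T b
indicator>0⇒T true _ = tt

countF>0⇒∃ : (p : Fin n → Bool) → 1 ≤ countF p → ∃ λ i → T (p i)
countF>0⇒∃ p pos with sumF>0⇒∃>0 (indicator ∘ p) pos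
... | i , pi>0 = i , indicator>0⇒T (p i) pi>0

countF≡0⇒≡false : (p : Fin n → Bool) → countF p ≡ 0 → ∀ i → p i ≡ false
countF≡0⇒≡false p eq i = indicator≡0⇒false (p i) (sumF≡0⇒≡0 (indicator ∘ p) eq i)
  where
  indicator≡0⇒false : ∀ b → indicator b ≡ 0 → b ≡ false
  indicator≡0⇒false false _ = refl

countF-*-≤ : (p : Fin n → Bool) (f : Fin n → ℕ) (c : ℕ) → (∀ i → T (p i) → c ≤ f i) → countF p * c ≤ sumF f
countF-*-≤ {zero}  p f c c≤f = z≤n
countF-*-≤ {suc n} p f c c≤f with p F.zero in eq
... | true  = +-mono-≤ (c≤f F.zero (subst T (sym eq) tt)) (countF-*-≤ (p ∘ F.suc) (f ∘ F.suc) c (c≤f ∘ F.suc))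
... | false = ≤-trans (countF-*-≤ (p ∘ F.suc) (f ∘ F.suc) c (c≤f ∘ F.suc)) (m≤n+m _ (f F.zero))

countF-∧ : (p q : Fin n → Bool) → countF p + countF q ≤ n + countF (λ i → p i ∧ q i)
countF-∧ {n} p q = begin
  countF p + countF q                                     ≡⟨ sumF-+ (indicator ∘ p) (indicator ∘ q) ⟨
  sumF (λ i → indicator (p i) + indicator (q i))          ≤⟨ sumF-mono-≤ (λ i → pointwise (p i) (q i)) ⟩
  sumF (λ i → 1 + indicator (p i ∧ q i))                  ≡⟨ sumF-+ (const 1) (λ i → indicator (p i ∧ q i)) ⟩
  sumF {n} (const 1) + countF (λ i → p i ∧ q i)           ≡⟨ cong (_+ countF (λ i → p i ∧ q i)) (trans (sumF-const {n} 1) (*-identityʳ n)) ⟩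
  n + countF (λ i → p i ∧ q i)                            ∎
  where
  open ≤-Reasoning
  pointwise : ∀ a b → indicator a + indicator b ≤ 1 + indicator (a ∧ b)
  pointwise true  true  = ≤-refl
  pointwise true  false = ≤-refl
  pointwise false true  = ≤-refl
  pointwise false false = z≤n

countF-pigeonhole : (p q : Fin n → Bool) → suc n ≤ countF p + countF q → ∃ λ i → T (p i) × T (q i)
countF-pigeonhole {n} p q le with countF>0⇒∃ (λ i → p i ∧ q i) (+-cancelˡ-≤ n 1 _ (≤-trans (≤-reflexive (+-comm n 1)) (≤-trans le (countF-∧ p q))))
... | i , pq = i , Equivalence.to T-∧ pq

countF≤1 : (p : Fin n → Bool) (a : Fin n) → (∀ i → T (p i) → i ≡ a) → countF p ≤ 1
countF≤1 {n} p a only-a = begin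
  countF p                                   ≡⟨ sumF-updateAt (indicator ∘ p) a ⟩
  indicator (p a) + sumF rest                ≡⟨ cong (indicator (p a) +_) rest≡0 ⟩
  indicator (p a) + 0                        ≤⟨ +-monoˡ-≤ 0 (indicator≤1 (p a)) ⟩
  1                                          ∎
  where
  open ≤-Reasoning
  rest = updateAt (indicator ∘ p) a (const 0)
  vanishes : ∀ i → rest i ≡ 0
  vanishes i with i FP.≟ a | p i in pi
  ... | yes refl | _     = updateAt-updates a (indicator ∘ p)
  ... | no  i≢a  | false = trans (updateAt-minimal i a (indicator ∘ p) i≢a) (cong indicator pi)
  ... | no  i≢a  | true  = ⊥-elim (i≢a (only-a i (subst T (sym pi) tt)))
  rest≡0 : sumF rest ≡ 0
  rest≡0 = trans (sumF-cong vanishes) (trans (sumF-const {n} 0) (*-zeroʳ n))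

record ExactlyAt₂ (p : Fin n → Bool) (a b : Fin n) : Set where
  field
    distinct : a ≢ b
    holds₁   : T (p a)
    holds₂   : T (p b)
    only     : ∀ c → T (p c) → c ≡ a ⊎ c ≡ b

countF≡2⇒ExactlyAt₂ : (p : Fin n → Bool) → countF p ≡ 2 → Σ (Fin n) λ a → Σ (Fin n) λ b → ExactlyAt₂ p a b
countF≡2⇒ExactlyAt₂ p count≡2 with countF>0⇒∃ p (≤-trans (s≤s z≤n) (≤-reflexive (sym count≡2)))
... | a , pa with FP.any? (λ i → T? (p i) ×-dec ¬? (i FP.≟ a))
...   | no ∄b = ⊥-elim (<⇒≱ (≤-reflexive (sym count≡2)) (countF≤1 p a only-a))
  where
  only-a : ∀ i → T (p i) → i ≡ a
  only-a i pi with i FP.≟ a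
  ... | yes i≡a = i≡a
  ... | no  i≢a = ⊥-elim (∄b (i , pi , i≢a))
...   | yes (b , pb , b≢a) = a , b , record { distinct = b≢a ∘ sym ; holds₁ = pa ; holds₂ = pb ; only = only-ab }
  where
  only-ab : ∀ c → T (p c) → c ≡ a ⊎ c ≡ b
  only-ab c pc with c FP.≟ a | c FP.≟ b
  ... | yes c≡a | _       = inj₁ c≡a
  ... | no  _   | yes c≡b = inj₂ c≡b
  ... | no  c≢a | no  c≢b = ⊥-elim (n≮n 2 (begin
    3                                              ≡⟨ cong₂ _+_ (cong₂ _+_ (one pa) (one pb)) (one pc) ⟨
    indicator (p a) + indicator (p b) + indicator (p c)
                                                   ≤⟨ ≤-sumF₃ (indicator ∘ p) (b≢a ∘ sym) (c≢a ∘ sym) (c≢b ∘ sym) ⟩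
    countF p                                       ≡⟨ count≡2 ⟩
    2                                              ∎))
    where
    open ≤-Reasoning
    one : ∀ {x} → T x → indicator x ≡ 1
    one {true} _ = refl

sumF-sucAt : (f g : Fin n → ℕ) (i : Fin n) → g i ≡ suc (f i) → (∀ j → j ≢ i → g j ≡ f j) →
             sumF g ≡ suc (sumF f)
sumF-sucAt f g i gi≡1+fi g≗f = begin
  sumF g                                  ≡⟨ sumF-updateAt g i ⟩
  g i + sumF (updateAt g i (const 0))     ≡⟨ cong₂ _+_ gi≡1+fi (sumF-cong rest-agree) ⟩
  suc (f i) + sumF (updateAt f i (const 0)) ≡⟨ cong suc (sumF-updateAt f i) ⟨
  suc (sumF f)                            ∎
  where
  open ≡-Reasoning
  rest-agree : ∀ j → updateAt g i (const 0) j ≡ updateAt f i (const 0) j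
  rest-agree j with j FP.≟ i
  ... | yes refl = trans (updateAt-updates i g) (sym (updateAt-updates i f))
  ... | no  j≢i  = trans (updateAt-minimal j i g j≢i) (trans (g≗f j j≢i) (sym (updateAt-minimal j i f j≢i)))

-- Non-edges and closure edges

private variable
  G H : BipGraph n

infix  4 _⊆_
infixl 30 _ᵀ

_ᵀ : BipGraph n → BipGraph n
(G ᵀ) x y = G y x

_⊆_ : BipGraph n → BipGraph n → Set
G ⊆ H = ∀ x y → T (G x y) → T (H x y)

⊆-ᵀ : G ⊆ H → G ᵀ ⊆ H ᵀ
⊆-ᵀ G⊆H x y = G⊆H y x

coDegX : BipGraph n → Fin n → ℕ
coDegX G x = countF (λ y → not (G x y))

coDegY : BipGraph n → Fin n → ℕ
coDegY G = coDegX (G ᵀ)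

nonEdges : BipGraph n → ℕ
nonEdges G = sumF (coDegX G)

degX+coDegX≡n : (G : BipGraph n) (x : Fin n) → degX G x + coDegX G x ≡ n
degX+coDegX≡n G x = countF-complement (G x)

edges+nonEdges≡n*n : (G : BipGraph n) → edges G + nonEdges G ≡ n * n
edges+nonEdges≡n*n {n} G = begin
  edges G + nonEdges G                    ≡⟨ sumF-+ (degX G) (coDegX G) ⟨
  sumF (λ x → degX G x + coDegX G x)      ≡⟨ sumF-cong (degX+coDegX≡n G) ⟩
  sumF {n} (const n)                      ≡⟨ sumF-const {n} n ⟩
  n * n                                   ∎
  where open ≡-Reasoning

nonEdges-ᵀ : (G : BipGraph n) → nonEdges (G ᵀ) ≡ nonEdges G
nonEdges-ᵀ G = sumF-comm (λ y x → indicator (not (G x y)))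

nonEdge⇒coDegX>0 : (G : BipGraph n) (x y : Fin n) → G x y ≡ false → 1 ≤ coDegX G x
nonEdge⇒coDegX>0 G x y Gxy≡false =
  subst (_≤ coDegX G x) (cong (indicator ∘ not) Gxy≡false) (≤-sumF (λ z → indicator (not (G x z))) y)

degX-mono : G ⊆ H → ∀ x → degX G x ≤ degX H x
degX-mono {G = G} {H = H} G⊆H x = sumF-mono-≤ (λ y → pointwise (G⊆H x y))
  where
  pointwise : ∀ {a b} → (T a → T b) → indicator a ≤ indicator b
  pointwise {true}  {true}  _   = ≤-refl
  pointwise {true}  {false} a⇒b = ⊥-elim (a⇒b tt)
  pointwise {false} {b}     _   = z≤n

MinDeg≥2-mono : G ⊆ H → MinDeg≥2 G → MinDeg≥2 H
MinDeg≥2-mono G⊆H (δX , δY) = (λ x → ≤-trans (δX x) (degX-mono G⊆H x)) , (λ y → ≤-trans (δY y) (degX-mono (⊆-ᵀ G⊆H) y))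

addEdge : BipGraph n → Fin n → Fin n → BipGraph n
addEdge G x y a b = G a b ∨ (does (a FP.≟ x) ∧ does (b FP.≟ y))

addEdge-new : (G : BipGraph n) (x y : Fin n) → addEdge G x y x y ≡ true
addEdge-new G x y rewrite dec-true (x FP.≟ x) refl | dec-true (y FP.≟ y) refl = ∨-zeroʳ (G x y)

addEdge-old : (G : BipGraph n) {x y a b : Fin n} → a ≢ x ⊎ b ≢ y → addEdge G x y a b ≡ G a b
addEdge-old G {x} {y} {a} {b} (inj₁ a≢x) rewrite dec-false (a FP.≟ x) a≢x = ∨-identityʳ (G a b)
addEdge-old G {x} {y} {a} {b} (inj₂ b≢y) rewrite dec-false (b FP.≟ y) b≢y | ∧-zeroʳ (does (a FP.≟ x)) = ∨-identityʳ (G a b)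

infix 4 _⊆_∪[_,_]

_⊆_∪[_,_] : BipGraph n → BipGraph n → Fin n → Fin n → Set
H ⊆ G ∪[ x , y ] = ∀ a b → T (H a b) → T (G a b) ⊎ (a ≡ x × b ≡ y)

⊆∪-ᵀ : ∀ {x y} → H ⊆ G ∪[ x , y ] → H ᵀ ⊆ G ᵀ ∪[ y , x ]
⊆∪-ᵀ H⊆G∪xy a b e with H⊆G∪xy b a e
... | inj₁ old             = inj₁ old
... | inj₂ (b≡x , a≡y) = inj₂ (a≡y , b≡x)

addEdge-⊆∪ : (G : BipGraph n) (x y : Fin n) → addEdge G x y ⊆ G ∪[ x , y ]
addEdge-⊆∪ G x y a b e with Equivalence.to T-∨ e
... | inj₁ old = inj₁ old
... | inj₂ new with a FP.≟ x | b FP.≟ y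
...   | yes a≡x | yes b≡y = inj₂ (a≡x , b≡y)
...   | yes _   | no  _   = ⊥-elim new
...   | no  _   | _       = ⊥-elim new

⊆-addEdge : (G : BipGraph n) (x y : Fin n) → G ⊆ addEdge G x y
⊆-addEdge G x y a b e = Equivalence.from T-∨ (inj₁ e)

nonEdges-addEdge : (G : BipGraph n) (x y : Fin n) → G x y ≡ false → nonEdges G ≡ suc (nonEdges (addEdge G x y))
nonEdges-addEdge G x y Gxy≡false = sumF-sucAt (coDegX G′) (coDegX G) x row-x other-rows
  where
  G′ = addEdge G x y
  row-x : coDegX G x ≡ suc (coDegX G′ x)
  row-x = sumF-sucAt (λ b → indicator (not (G′ x b))) (λ b → indicator (not (G x b))) y
    (trans (cong (indicator ∘ not) Gxy≡false) (cong (suc ∘ indicator ∘ not) (sym (addEdge-new G x y))))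
    (λ b b≢y → cong (indicator ∘ not) (sym (addEdge-old G {x} {y} {x} {b} (inj₂ b≢y))))
  other-rows : ∀ a → a ≢ x → coDegX G a ≡ coDegX G′ a
  other-rows a a≢x = sumF-cong (λ b → cong (indicator ∘ not) (sym (addEdge-old G {x} {y} {a} {b} (inj₁ a≢x))))

-- Hamiltonian cycles of bipartite graphs

private variable
  m : ℕ

next : Fin (suc m) → Fin (suc m)
next i with view i
... | ‵fromℕ     = F.zero
... | ‵inject₁ j = F.suc j

prev : Fin (suc m) → Fin (suc m)
prev F.zero    = fromℕ _
prev (F.suc j) = inject₁ j

next-fromℕ : next (fromℕ m) ≡ F.zero
next-fromℕ {m} rewrite view-fromℕ m = refl

next-inject₁ : (j : Fin m) → next (inject₁ j) ≡ F.suc j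
next-inject₁ j rewrite view-inject₁ j = refl

next-prev : (i : Fin (suc m)) → next (prev i) ≡ i
next-prev F.zero    = next-fromℕ
next-prev (F.suc j) = next-inject₁ j

prev-next : (i : Fin (suc m)) → prev (next i) ≡ i
prev-next i = go (view i)
  where
  go : ∀ {i} → View i → prev (next i) ≡ i
  go ‵fromℕ       = cong prev next-fromℕ
  go (‵inject₁ j) = cong prev (next-inject₁ j)

nextP : Permutation′ (suc m)
nextP = Perm.permutation next prev next-prev prev-next

private variable
  σ τ : Permutation′ (suc m)

-- The cycle σ 0, τ 0, σ 1, τ 1, …, σ m, τ m, σ 0.
record IsHamCycle (E : BipGraph (suc m)) (σ τ : Permutation′ (suc m)) : Set where
  field
    rung : ∀ i → T (E (σ ⟨$⟩ʳ i) (τ ⟨$⟩ʳ i))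
    step : ∀ i → T (E (σ ⟨$⟩ʳ next i) (τ ⟨$⟩ʳ i))

HamCycle : BipGraph (suc m) → Set
HamCycle E = Σ (Permutation′ _) λ σ → Σ (Permutation′ _) λ τ → IsHamCycle E σ τ

-- The path σ 0, τ 0, σ 1, τ 1, …, σ m, τ m.
record IsHamPath (E : BipGraph (suc m)) (σ τ : Permutation′ (suc m)) : Set where
  field
    rung : ∀ i → T (E (σ ⟨$⟩ʳ i) (τ ⟨$⟩ʳ i))
    step : ∀ j → T (E (σ ⟨$⟩ʳ F.suc j) (τ ⟨$⟩ʳ inject₁ j))

private variable
  E : BipGraph (suc m)

IsHamCycle-rotate : IsHamCycle E σ τ → IsHamCycle E (nextP ∘ₚ σ) (nextP ∘ₚ τ)
IsHamCycle-rotate c = record { rung = rung ∘ next ; step = step ∘ next }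
  where open IsHamCycle c

IsHamCycle-ᵀ : IsHamCycle E σ τ → IsHamCycle (E ᵀ) τ (nextP ∘ₚ σ)
IsHamCycle-ᵀ c = record { rung = step ; step = rung ∘ next }
  where open IsHamCycle c

HamCycle-ᵀ : HamCycle (E ᵀ) → HamCycle E
HamCycle-ᵀ (σ , τ , c) = τ , nextP ∘ₚ σ , IsHamCycle-ᵀ c

IsHamPath-close : IsHamPath E σ τ → T (E (σ ⟨$⟩ʳ F.zero) (τ ⟨$⟩ʳ fromℕ m)) → IsHamCycle E σ τ
IsHamPath-close {m = m} {E = E} {σ = σ} {τ = τ} path closing = record { rung = rung ; step = λ i → step′ (view i) }
  where
  open IsHamPath path
  step′ : ∀ {i} → View i → T (E (σ ⟨$⟩ʳ next i) (τ ⟨$⟩ʳ i))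
  step′ ‵fromℕ       = subst (λ k → T (E (σ ⟨$⟩ʳ k) (τ ⟨$⟩ʳ fromℕ m))) (sym next-fromℕ) closing
  step′ (‵inject₁ j) = subst (λ k → T (E (σ ⟨$⟩ʳ k) (τ ⟨$⟩ʳ inject₁ j))) (sym (next-inject₁ j)) (step j)

-- Reverses the block of positions s, s + 1, …, m.
reflectFrom : ℕ → Fin (suc m) → Fin (suc m)
reflectFrom {m} s k with toℕ k <? s
... | yes _   = k
... | no  k≮s = fromℕ< (s≤s (begin
  m + s ∸ toℕ k       ≤⟨ ∸-monoˡ-≤ (toℕ k) (+-monoʳ-≤ m (≮⇒≥ k≮s)) ⟩
  m + toℕ k ∸ toℕ k   ≡⟨ m+n∸n≡m m (toℕ k) ⟩
  m                   ∎))
  where open ≤-Reasoning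

reflectFrom-< : ∀ s (k : Fin (suc m)) → toℕ k < s → reflectFrom s k ≡ k
reflectFrom-< s k k<s with toℕ k <? s
... | yes _   = refl
... | no  k≮s = ⊥-elim (k≮s k<s)

toℕ-reflectFrom-≥ : ∀ s (k : Fin (suc m)) → s ≤ toℕ k → toℕ (reflectFrom s k) + toℕ k ≡ m + s
toℕ-reflectFrom-≥ {m} s k s≤k with toℕ k <? s
... | yes k<s = ⊥-elim (<⇒≱ k<s s≤k)
... | no  k≮s = begin
  toℕ (fromℕ< _) + toℕ k  ≡⟨ cong (_+ toℕ k) (FP.toℕ-fromℕ< _) ⟩
  m + s ∸ toℕ k + toℕ k   ≡⟨ m∸n+n≡m (≤-trans (≤-pred (FP.toℕ<n k)) (m≤m+n m s)) ⟩
  m + s                   ∎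
  where open ≡-Reasoning

reflectFrom-≥-unique : ∀ s (k i : Fin (suc m)) → s ≤ toℕ k → toℕ i + toℕ k ≡ m + s → reflectFrom s k ≡ i
reflectFrom-≥-unique s k i s≤k i+k≡m+s =
  FP.toℕ-injective (+-cancelʳ-≡ (toℕ k) _ _ (trans (toℕ-reflectFrom-≥ s k s≤k) (sym i+k≡m+s)))

reflectFrom-involutive : ∀ s (k : Fin (suc m)) → reflectFrom s (reflectFrom s k) ≡ k
reflectFrom-involutive {m} s k = by-cases (toℕ k <? s)
  where
  by-cases : Dec (toℕ k < s) → reflectFrom s (reflectFrom s k) ≡ k
  by-cases (yes k<s) = trans (cong (reflectFrom s) (reflectFrom-< s k k<s)) (reflectFrom-< s k k<s)
  by-cases (no  k≮s) = reflectFrom-≥-unique s r k s≤r (trans (+-comm (toℕ k) (toℕ r)) r+k≡m+s)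
    where
    r = reflectFrom s k
    r+k≡m+s : toℕ r + toℕ k ≡ m + s
    r+k≡m+s = toℕ-reflectFrom-≥ s k (≮⇒≥ k≮s)
    s≤r : s ≤ toℕ r
    s≤r = +-cancelˡ-≤ m s (toℕ r) (begin
      m + s          ≡⟨ r+k≡m+s ⟨
      toℕ r + toℕ k  ≤⟨ +-monoʳ-≤ (toℕ r) (≤-pred (FP.toℕ<n k)) ⟩
      toℕ r + m      ≡⟨ +-comm (toℕ r) m ⟩
      m + toℕ r      ∎)
      where open ≤-Reasoning

reflectFrom-self : (k : Fin (suc m)) → reflectFrom (toℕ k) k ≡ fromℕ m
reflectFrom-self {m} k = reflectFrom-≥-unique (toℕ k) k (fromℕ m) ≤-refl (cong (_+ toℕ k) (FP.toℕ-fromℕ m))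

reflectFrom-fromℕ : (j : Fin m) → reflectFrom (toℕ j) (fromℕ m) ≡ inject₁ j
reflectFrom-fromℕ {m} j = reflectFrom-≥-unique (toℕ j) (fromℕ m) (inject₁ j)
  (subst (toℕ j ≤_) (sym (FP.toℕ-fromℕ m)) (<⇒≤ (FP.toℕ<n j)))
  (trans (cong₂ _+_ (FP.toℕ-inject₁ j) (FP.toℕ-fromℕ m)) (+-comm (toℕ j) m))

reflectFrom-suc : ∀ s (k : Fin (suc m)) → s < toℕ k →
                  Σ (Fin m) λ i → reflectFrom s k ≡ inject₁ i × reflectFrom (suc s) k ≡ F.suc i
reflectFrom-suc {m} s k s<k = i , sym (FP.inject₁-lower₁ r m≢r) , reflectFrom-≥-unique (suc s) k (F.suc i) s<k (begin
  suc (toℕ i) + toℕ k  ≡⟨ cong (λ t → suc t + toℕ k) (FP.toℕ-lower₁ r m≢r) ⟩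
  suc (toℕ r + toℕ k)  ≡⟨ cong suc r+k≡m+s ⟩
  suc (m + s)          ≡⟨ +-suc m s ⟨
  m + suc s            ∎)
  where
  open ≡-Reasoning
  r = reflectFrom s k
  r+k≡m+s : toℕ r + toℕ k ≡ m + s
  r+k≡m+s = toℕ-reflectFrom-≥ s k (<⇒≤ s<k)
  m≢r : m ≢ toℕ r
  m≢r = ≢-sym (<⇒≢ (+-cancelʳ-< (toℕ k) (toℕ r) m (subst (_< m + toℕ k) (sym r+k≡m+s) (+-monoʳ-< m s<k))))
  i = F.lower₁ r m≢r

reflectFrom-suc-inject₁ : ∀ s (j : Fin m) → s ≤ toℕ j → reflectFrom (suc s) (F.suc j) ≡ reflectFrom s (inject₁ j)
reflectFrom-suc-inject₁ {m} s j s≤j = reflectFrom-≥-unique (suc s) (F.suc j) r (s≤s s≤j) (begin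
  toℕ r + suc (toℕ j)            ≡⟨ +-suc (toℕ r) (toℕ j) ⟩
  suc (toℕ r + toℕ j)            ≡⟨ cong (λ t → suc (toℕ r + t)) (FP.toℕ-inject₁ j) ⟨
  suc (toℕ r + toℕ (inject₁ j))  ≡⟨ cong suc (toℕ-reflectFrom-≥ s (inject₁ j) (subst (s ≤_) (sym (FP.toℕ-inject₁ j)) s≤j)) ⟩
  suc (m + s)                    ≡⟨ +-suc m s ⟨
  m + suc s                      ∎)
  where
  open ≡-Reasoning
  r = reflectFrom s (inject₁ j)

reflectionP : ℕ → Permutation′ (suc m)
reflectionP s = Perm.permutation (reflectFrom s) (reflectFrom s) (reflectFrom-involutive s) (reflectFrom-involutive s)

-- Pósa's crossing: x = σ 0 ∼ τ j and σ j ∼ τ m = y turn the path into the cycle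
-- σ 0, τ 0, …, σ j, τ m, σ m, …, τ j, σ 0.
IsHamPath-cross : IsHamPath E σ τ → (j : Fin m) →
                  T (E (σ ⟨$⟩ʳ F.zero) (τ ⟨$⟩ʳ inject₁ j)) → T (E (σ ⟨$⟩ʳ inject₁ j) (τ ⟨$⟩ʳ fromℕ m)) →
                  IsHamCycle E (reflectionP (suc (toℕ j)) ∘ₚ σ) (reflectionP (toℕ j) ∘ₚ τ)
IsHamPath-cross {m = m} {E = E} {σ = σ} {τ = τ} path j x∼τj σj∼y =
  IsHamPath-close (record { rung = rung′ ; step = step′ }) closing
  where
  open IsHamPath path
  s = toℕ j
  edge : ∀ {a b a′ b′} → a ≡ a′ → b ≡ b′ → T (E (σ ⟨$⟩ʳ a′) (τ ⟨$⟩ʳ b′)) → T (E (σ ⟨$⟩ʳ a) (τ ⟨$⟩ʳ b))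
  edge refl refl e = e

  closing : T (E (σ ⟨$⟩ʳ reflectFrom (suc s) F.zero) (τ ⟨$⟩ʳ reflectFrom s (fromℕ m)))
  closing = edge (reflectFrom-< (suc s) F.zero (s≤s z≤n)) (reflectFrom-fromℕ j) x∼τj

  rung′ : ∀ k → T (E (σ ⟨$⟩ʳ reflectFrom (suc s) k) (τ ⟨$⟩ʳ reflectFrom s k))
  rung′ k with <-cmp (toℕ k) s
  ... | tri< k<s _ _ = edge (reflectFrom-< (suc s) k (m<n⇒m<1+n k<s)) (reflectFrom-< s k k<s) (rung k)
  ... | tri≈ _ k≡s _ = edge (trans (reflectFrom-< (suc s) k (s≤s (≤-reflexive k≡s))) k≡j)
                            (subst (λ t → reflectFrom t k ≡ fromℕ m) k≡s (reflectFrom-self k)) σj∼y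
    where
    k≡j : k ≡ inject₁ j
    k≡j = FP.toℕ-injective (trans k≡s (sym (FP.toℕ-inject₁ j)))
  ... | tri> _ _ s<k with reflectFrom-suc s k s<k
  ...   | i , ρk≡i , ρ′k≡1+i = edge ρ′k≡1+i ρk≡i (step i)

  step′ : ∀ j′ → T (E (σ ⟨$⟩ʳ reflectFrom (suc s) (F.suc j′)) (τ ⟨$⟩ʳ reflectFrom s (inject₁ j′)))
  step′ j′ with toℕ j′ <? s
  ... | yes j′<s = edge (reflectFrom-< (suc s) (F.suc j′) (s≤s j′<s))
                        (reflectFrom-< s (inject₁ j′) (subst (_< s) (sym (FP.toℕ-inject₁ j′)) j′<s))
                        (step j′)
  ... | no  j′≮s = edge (reflectFrom-suc-inject₁ s j′ (≮⇒≥ j′≮s)) refl (rung _)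

IsHamPath⇒HamCycle : (G : BipGraph (suc m)) → IsHamPath G σ τ →
                     suc (suc m) ≤ degX G (σ ⟨$⟩ʳ F.zero) + degY G (τ ⟨$⟩ʳ fromℕ m) → HamCycle G
IsHamPath⇒HamCycle {m = m} {σ = σ} {τ = τ} G path deg-sum with countF-pigeonhole x∼τ σ∼y deg-sum′
  where
  x = σ ⟨$⟩ʳ F.zero
  y = τ ⟨$⟩ʳ fromℕ m
  x∼τ σ∼y : Fin (suc m) → Bool
  x∼τ i = G x (τ ⟨$⟩ʳ i)
  σ∼y i = G (σ ⟨$⟩ʳ i) y
  deg-sum′ : suc (suc m) ≤ countF x∼τ + countF σ∼y
  deg-sum′ = subst (suc (suc m) ≤_)
    (sym (cong₂ _+_ (sumF-permute (indicator ∘ G x) τ) (sumF-permute (λ a → indicator (G a y)) σ))) deg-sum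
... | i , x∼τi , σi∼y = by-position (view i) x∼τi σi∼y
  where
  by-position : ∀ {i} → View i → T (G (σ ⟨$⟩ʳ F.zero) (τ ⟨$⟩ʳ i)) → T (G (σ ⟨$⟩ʳ i) (τ ⟨$⟩ʳ fromℕ m)) → HamCycle G
  by-position ‵fromℕ       x∼y _ = σ , τ , IsHamPath-close path x∼y
  by-position (‵inject₁ j) x∼τj σj∼y = _ , _ , IsHamPath-cross path j x∼τj σj∼y

⟨$⟩ʳ-injective : (π : Permutation′ n) → ∀ {i j} → π ⟨$⟩ʳ i ≡ π ⟨$⟩ʳ j → i ≡ j
⟨$⟩ʳ-injective π = Injection.injective (↔⇒↣ π)

IsHamCycle-rotateTo : IsHamCycle E σ τ → (p : Fin (suc m)) →
  Σ (Permutation′ (suc m)) λ σ′ → Σ (Permutation′ (suc m)) λ τ′ →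
    IsHamCycle E σ′ τ′ × σ′ ⟨$⟩ʳ F.zero ≡ σ ⟨$⟩ʳ next p × τ′ ⟨$⟩ʳ fromℕ m ≡ τ ⟨$⟩ʳ p
IsHamCycle-rotateTo {m = m} {E = E} c p = go (toℕ p) p refl c
  where
  go : ∀ k p {σ τ} → toℕ p ≡ k → IsHamCycle E σ τ →
       Σ (Permutation′ (suc m)) λ σ′ → Σ (Permutation′ (suc m)) λ τ′ →
         IsHamCycle E σ′ τ′ × σ′ ⟨$⟩ʳ F.zero ≡ σ ⟨$⟩ʳ next p × τ′ ⟨$⟩ʳ fromℕ m ≡ τ ⟨$⟩ʳ p
  go zero    F.zero    {σ} {τ} _  c =
    nextP ∘ₚ σ , nextP ∘ₚ τ , IsHamCycle-rotate c , refl , cong (τ ⟨$⟩ʳ_) next-fromℕ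
  go (suc k) (F.suc j) {σ} {τ} eq c
    with go k (inject₁ j) (trans (FP.toℕ-inject₁ j) (suc-injective eq)) (IsHamCycle-rotate c)
  ... | σ′ , τ′ , c′ , σ′0≡ , τ′m≡ =
    σ′ , τ′ , c′ , trans σ′0≡ (cong (λ q → σ ⟨$⟩ʳ next q) (next-inject₁ j))
                 , trans τ′m≡ (cong (τ ⟨$⟩ʳ_) (next-inject₁ j))

-- The cycle steps from y = τ p to x = σ (next p); cut there, it is a path of G from x to y.
HamCycle-through : (G H : BipGraph (suc (suc m))) (x y : Fin (suc (suc m))) → H ⊆ G ∪[ x , y ] →
                   suc (suc (suc m)) ≤ degX G x + degY G y →
                   IsHamCycle H σ τ → (p : Fin (suc (suc m))) → σ ⟨$⟩ʳ next p ≡ x → τ ⟨$⟩ʳ p ≡ y → HamCycle G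
HamCycle-through {m = m} {σ = σ} {τ = τ} G H x y H⊆G∪xy deg-sum c p σ[1+p]≡x τp≡y
  with IsHamCycle-rotateTo c p
... | σ′ , τ′ , c′ , σ′0≡ , τ′m≡ =
  IsHamPath⇒HamCycle G path (subst₂ (λ a b → suc (suc (suc m)) ≤ degX G a + degY G b) (sym x≡) (sym y≡) deg-sum)
  where
  open IsHamCycle c′
  x≡ : σ′ ⟨$⟩ʳ F.zero ≡ x
  x≡ = trans σ′0≡ σ[1+p]≡x
  y≡ : τ′ ⟨$⟩ʳ fromℕ (suc m) ≡ y
  y≡ = trans τ′m≡ τp≡y
  ends-at-y : ∀ {i} → τ′ ⟨$⟩ʳ i ≡ y → i ≡ fromℕ (suc m)
  ends-at-y τ′i≡y = ⟨$⟩ʳ-injective τ′ (trans τ′i≡y (sym y≡))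
  path : IsHamPath G σ′ τ′
  path = record { rung = rung′ ; step = step′ }
    where
    rung′ : ∀ i → T (G (σ′ ⟨$⟩ʳ i) (τ′ ⟨$⟩ʳ i))
    rung′ i with H⊆G∪xy _ _ (rung i)
    ... | inj₁ e                = e
    ... | inj₂ (σ′i≡x , τ′i≡y) with ⟨$⟩ʳ-injective σ′ (trans σ′i≡x (sym x≡)) | ends-at-y τ′i≡y
    ...   | refl | ()
    step′ : ∀ j → T (G (σ′ ⟨$⟩ʳ F.suc j) (τ′ ⟨$⟩ʳ inject₁ j))
    step′ j with H⊆G∪xy _ _ (subst (λ k → T (H (σ′ ⟨$⟩ʳ k) (τ′ ⟨$⟩ʳ inject₁ j))) (next-inject₁ j) (step (inject₁ j)))
    ... | inj₁ e            = e
    ... | inj₂ (_ , τ′j≡y) = ⊥-elim (FP.fromℕ≢inject₁ (sym (ends-at-y τ′j≡y)))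

HamCycle-removeEdge : (G H : BipGraph (suc (suc m))) (x y : Fin (suc (suc m))) → H ⊆ G ∪[ x , y ] →
                      suc (suc (suc m)) ≤ degX G x + degY G y → HamCycle H → HamCycle G
HamCycle-removeEdge {m = m} G H x y H⊆G∪xy deg-sum (σ , τ , c)
  with FP.any? (λ p → (σ ⟨$⟩ʳ next p FP.≟ x) ×-dec (τ ⟨$⟩ʳ p FP.≟ y))
... | yes (p , σ[1+p]≡x , τp≡y) = HamCycle-through G H x y H⊆G∪xy deg-sum c p σ[1+p]≡x τp≡y
... | no ∄step with FP.any? (λ p → (σ ⟨$⟩ʳ p FP.≟ x) ×-dec (τ ⟨$⟩ʳ p FP.≟ y))
...   | yes (p , σp≡x , τp≡y) =
  HamCycle-ᵀ (HamCycle-through (G ᵀ) (H ᵀ) y x (⊆∪-ᵀ H⊆G∪xy) (subst (suc (suc (suc m)) ≤_) (+-comm (degX G x) (degY G y)) deg-sum)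
               (IsHamCycle-ᵀ c) (prev p) (trans (cong (τ ⟨$⟩ʳ_) (next-prev p)) τp≡y)
               (trans (cong (σ ⟨$⟩ʳ_) (next-prev p)) σp≡x))
...   | no ∄rung = σ , τ , record
  { rung = λ i → in-G (rung i) (λ e → ∄rung (i , e))
  ; step = λ i → in-G (step i) (λ e → ∄step (i , e))
  }
  where
  open IsHamCycle c
  in-G : ∀ {a b} → T (H a b) → ¬ (a ≡ x × b ≡ y) → T (G a b)
  in-G {a} {b} e not-xy with H⊆G∪xy a b e
  ... | inj₁ e′ = e′
  ... | inj₂ xy = ⊥-elim (not-xy xy)

CycNext⇒≡next : (i i′ : Fin (suc m)) → CycNext (suc m) i i′ → i′ ≡ next i
CycNext⇒≡next {m} i i′ = go (view i)
  where
  go : ∀ {i} → View i → CycNext (suc m) i i′ → i′ ≡ next i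
  go ‵fromℕ (inj₁ 1+m≡i′) = ⊥-elim (<-irrefl (sym (trans (cong suc (sym (FP.toℕ-fromℕ m))) 1+m≡i′)) (FP.toℕ<n i′))
  go ‵fromℕ (inj₂ (_ , i′≡0)) = trans (FP.toℕ-injective i′≡0) (sym next-fromℕ)
  go (‵inject₁ j) (inj₁ 1+j≡i′) =
    trans (FP.toℕ-injective (trans (sym 1+j≡i′) (cong suc (FP.toℕ-inject₁ j)))) (sym (next-inject₁ j))
  go (‵inject₁ j) (inj₂ (1+j≡1+m , _)) =
    ⊥-elim (<-irrefl (suc-injective (trans (cong suc (sym (FP.toℕ-inject₁ j))) 1+j≡1+m)) (FP.toℕ<n j))

data Consecutive {m : ℕ} : Fin (suc m) × Fin 2 → Fin (suc m) × Fin 2 → Set where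
  rung : ∀ i → Consecutive (i , F.zero) (i , F.suc F.zero)
  step : ∀ i → Consecutive (i , F.suc F.zero) (next i , F.zero)

-- Position 2 i of the cycle holds σ i and position 2 i + 1 holds τ i.
position : ℕ → Fin 2 → ℕ
position u F.zero          = 2 * u
position u (F.suc F.zero) = suc (2 * u)

toℕ-combine : (i : Fin (suc m)) (a : Fin 2) → toℕ (F.combine i a) ≡ position (toℕ i) a
toℕ-combine i F.zero          = trans (FP.toℕ-combine i F.zero) (+-identityʳ (2 * toℕ i))
toℕ-combine i (F.suc F.zero) = trans (FP.toℕ-combine i (F.suc F.zero)) (+-comm (2 * toℕ i) 1)

consecutive : (i i′ : Fin (suc m)) (a b : Fin 2) → CycNext (suc m * 2) (F.combine i a) (F.combine i′ b) →
              Consecutive (i , a) (i′ , b)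
consecutive {m} i i′ a b = go a b ∘ subst₂ (SucMod (suc m * 2)) (toℕ-combine i a) (toℕ-combine i′ b)
  where
  I = toℕ i
  I′ = toℕ i′
  SucMod : ℕ → ℕ → ℕ → Set
  SucMod k u v = (suc u ≡ v) ⊎ ((suc u ≡ k) × (v ≡ 0))
  2N≡ : suc m * 2 ≡ 2 * suc m
  2N≡ = *-comm (suc m) 2
  go : ∀ a b → SucMod (suc m * 2) (position I a) (position I′ b) → Consecutive (i , a) (i′ , b)
  go F.zero         F.zero         (inj₁ e)       = ⊥-elim (even≢odd I′ I (sym e))
  go F.zero         F.zero         (inj₂ (e , _)) = ⊥-elim (even≢odd (suc m) I (sym (trans e 2N≡)))
  go F.zero         (F.suc F.zero) (inj₁ e)
    rewrite FP.toℕ-injective {i = i} {j = i′} (*-cancelˡ-≡ I I′ 2 (suc-injective e)) = rung i′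
  go F.zero         (F.suc F.zero) (inj₂ (_ , ()))
  go (F.suc F.zero) F.zero         (inj₁ e)
    rewrite CycNext⇒≡next i i′ (inj₁ (*-cancelˡ-≡ (suc I) I′ 2 (trans (*-suc 2 I) e))) = step i
  go (F.suc F.zero) F.zero         (inj₂ (e , e′))
    rewrite CycNext⇒≡next i i′ (inj₂ (*-cancelˡ-≡ (suc I) (suc m) 2 (trans (*-suc 2 I) (trans e 2N≡)) , m+n≡0⇒m≡0 I′ e′))
    = step i
  go (F.suc F.zero) (F.suc F.zero) (inj₁ e)       = ⊥-elim (even≢odd (suc I) I′ (trans (*-suc 2 I) e))
  go (F.suc F.zero) (F.suc F.zero) (inj₂ (_ , ()))

HamCycle⇒Hamiltonian : (G : BipGraph (suc (suc m))) → HamCycle G → Hamiltonian G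
HamCycle⇒Hamiltonian {m} G (σ , τ , c) = suc (suc m) * 2 , s≤s (s≤s (s≤s z≤n)) , vertexAt ↔-∘ FP.*↔× , adjacent
  where
  place : Fin (suc (suc m)) × Fin 2 → Vtx (suc (suc m))
  place (i , F.zero)       = inj₁ (σ ⟨$⟩ʳ i)
  place (i , F.suc F.zero) = inj₂ (τ ⟨$⟩ʳ i)
  unplace : Vtx (suc (suc m)) → Fin (suc (suc m)) × Fin 2
  unplace (inj₁ a) = σ ⟨$⟩ˡ a , F.zero
  unplace (inj₂ b) = τ ⟨$⟩ˡ b , F.suc F.zero
  vertexAt : (Fin (suc (suc m)) × Fin 2) ↔ Vtx (suc (suc m))
  vertexAt = mk↔ₛ′ place unplace place-unplace unplace-place
    where
    place-unplace : ∀ v → place (unplace v) ≡ v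
    place-unplace (inj₁ a) = cong inj₁ (Perm.inverseʳ σ)
    place-unplace (inj₂ b) = cong inj₂ (Perm.inverseʳ τ)
    unplace-place : ∀ p → unplace (place p) ≡ p
    unplace-place (i , F.zero)       = cong (_, F.zero) (Perm.inverseˡ σ)
    unplace-place (i , F.suc F.zero) = cong (_, F.suc F.zero) (Perm.inverseˡ τ)
  adjacent-places : ∀ {p q} → Consecutive p q → Adj G (place p) (place q)
  adjacent-places (rung i) = IsHamCycle.rung c i
  adjacent-places (step i) = IsHamCycle.step c i
  adjacent : ∀ p q → CycNext (suc (suc m) * 2) p q → Adj G (place (F.remQuot 2 p)) (place (F.remQuot 2 q))
  adjacent p q p→q with F.remQuot {suc (suc m)} 2 p in p≡ | F.remQuot {suc (suc m)} 2 q in q≡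
  ... | i , a | i′ , b = adjacent-places (consecutive i i′ a b (subst₂ (CycNext _) (positions p≡) (positions q≡) p→q))
    where
    positions : ∀ {p i a} → F.remQuot {suc (suc m)} 2 p ≡ (i , a) → p ≡ F.combine i a
    positions {p} eq = trans (sym (FP.combine-remQuot {suc (suc m)} 2 p)) (cong (uncurry F.combine) eq)

-- Isomorphism with K_{n,n−2}+4e

private variable
  G₁ G₂ G₃ : BipGraph n

≅-trans : G₁ ≅ G₂ → G₂ ≅ G₃ → G₁ ≅ G₃
≅-trans (φ , φ-adj) (ψ , ψ-adj) = ψ ↔-∘ φ , λ u v → ψ-adj (Inverse.to φ u) (Inverse.to φ v) ⇔-∘ φ-adj u v

≅-ᵀ : (G : BipGraph n) → G ≅ G ᵀ
≅-ᵀ G = swap-↔ , adj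
  where
  adj : ∀ u v → Adj G u v ⇔ Adj (G ᵀ) (swap u) (swap v)
  adj (inj₁ a) (inj₁ b) = mk⇔ id id
  adj (inj₁ a) (inj₂ b) = mk⇔ id id
  adj (inj₂ a) (inj₁ b) = mk⇔ id id
  adj (inj₂ a) (inj₂ b) = mk⇔ id id

relabel-≅ : (πX πY : Permutation′ n) → (∀ a b → G₁ a b ≡ G₂ (πX ⟨$⟩ʳ a) (πY ⟨$⟩ʳ b)) → G₁ ≅ G₂
relabel-≅ {G₁ = G₁} {G₂ = G₂} πX πY G₁≡G₂∘π = (πX ⊎-↔ πY) , adj
  where
  adj : ∀ u v → Adj G₁ u v ⇔ Adj G₂ (Inverse.to (πX ⊎-↔ πY) u) (Inverse.to (πX ⊎-↔ πY) v)
  adj (inj₁ a) (inj₁ b) = mk⇔ id id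
  adj (inj₁ a) (inj₂ b) = mk⇔ (subst T (G₁≡G₂∘π a b)) (subst T (sym (G₁≡G₂∘π a b)))
  adj (inj₂ b) (inj₁ a) = mk⇔ (subst T (G₁≡G₂∘π a b)) (subst T (sym (G₁≡G₂∘π a b)))
  adj (inj₂ a) (inj₂ b) = mk⇔ id id

transpose-here : (i j : Fin n) → Perm.transpose i j ⟨$⟩ʳ i ≡ j
transpose-here i j rewrite dec-true (i FP.≟ i) refl = refl

transpose-elsewhere : (i j k : Fin n) → k ≢ i → k ≢ j → Perm.transpose i j ⟨$⟩ʳ k ≡ k
transpose-elsewhere i j k k≢i k≢j rewrite dec-false (k FP.≟ i) k≢i | dec-false (k FP.≟ j) k≢j = refl

twoPointPermutation : {a₁ a₂ b₁ b₂ : Fin n} → a₁ ≢ a₂ → b₁ ≢ b₂ →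
                      Σ (Permutation′ n) λ π → π ⟨$⟩ʳ a₁ ≡ b₁ × π ⟨$⟩ʳ a₂ ≡ b₂
twoPointPermutation {a₁ = a₁} {a₂} {b₁} {b₂} a₁≢a₂ b₁≢b₂ = π₁ ∘ₚ π₂ , π₁₂a₁≡b₁ , transpose-here a₂′ b₂
  where
  π₁ = Perm.transpose a₁ b₁
  a₂′ = π₁ ⟨$⟩ʳ a₂
  b₁≢a₂′ : b₁ ≢ a₂′
  b₁≢a₂′ b₁≡a₂′ = a₁≢a₂ (⟨$⟩ʳ-injective π₁ (trans (transpose-here a₁ b₁) b₁≡a₂′))
  π₂ = Perm.transpose a₂′ b₂
  π₁₂a₁≡b₁ : π₂ ⟨$⟩ʳ (π₁ ⟨$⟩ʳ a₁) ≡ b₁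
  π₁₂a₁≡b₁ = trans (cong (π₂ ⟨$⟩ʳ_) (transpose-here a₁ b₁)) (transpose-elsewhere a₂′ b₂ b₁ b₁≢a₂′ b₁≢b₂)

-- The shape of K_{n,n-2}+4e seen from the side containing the two degree-2 vertices w₁, w₂.
record Kplus4eShape (G : BipGraph n) : Set where
  field
    u₁ u₂ w₁ w₂ : Fin n
    w₁≢w₂       : w₁ ≢ w₂
    N[w₁]≡u₁u₂  : ExactlyAt₂ (λ a → G a w₁) u₁ u₂
    N[w₂]≡N[w₁] : ∀ a → G a w₂ ≡ G a w₁
    complete    : ∀ a b → b ≢ w₁ → b ≢ w₂ → G a b ≡ true

Exceptional : BipGraph n → Set
Exceptional G = Kplus4eShape G ⊎ Kplus4eShape (G ᵀ)

Kplus4e-full : ∀ {k} (x y : Fin (suc (suc k))) → toℕ y < k → Kplus4e (suc (suc k)) x y ≡ true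
Kplus4e-full x y y<k rewrite Equivalence.to T-≡ (<⇒<ᵇ y<k) = refl

Kplus4e-special : ∀ {k} (x y : Fin (suc (suc k))) → k ≤ toℕ y → Kplus4e (suc (suc k)) x y ≡ (toℕ x <ᵇ 2)
Kplus4e-special {k} x y k≤y with toℕ y <ᵇ k in y<ᵇk
... | false = refl
... | true  = ⊥-elim (<⇒≱ (<ᵇ⇒< (toℕ y) k (subst T (sym y<ᵇk) tt)) k≤y)

module _ {k : ℕ} {G : BipGraph (suc (suc k))} (shape : Kplus4eShape G) where
  open Kplus4eShape shape
  open ExactlyAt₂ N[w₁]≡u₁u₂

  Kplus4eShape-relabel : (πX πY : Permutation′ (suc (suc k))) →
    πX ⟨$⟩ʳ u₁ ≡ F.zero → πX ⟨$⟩ʳ u₂ ≡ F.suc F.zero → πY ⟨$⟩ʳ w₁ ≡ inject₁ (fromℕ k) → πY ⟨$⟩ʳ w₂ ≡ fromℕ (suc k) →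
    ∀ a b → G a b ≡ Kplus4e (suc (suc k)) (πX ⟨$⟩ʳ a) (πY ⟨$⟩ʳ b)
  Kplus4eShape-relabel πX πY πXu₁≡0 πXu₂≡1 πYw₁≡k πYw₂≡1+k a b = by-cases (b FP.≟ w₁) (b FP.≟ w₂)
    where
    toℕ-πYw₁ : toℕ (πY ⟨$⟩ʳ w₁) ≡ k
    toℕ-πYw₁ = trans (cong toℕ πYw₁≡k) (trans (FP.toℕ-inject₁ (fromℕ k)) (FP.toℕ-fromℕ k))
    toℕ-πYw₂ : toℕ (πY ⟨$⟩ʳ w₂) ≡ suc k
    toℕ-πYw₂ = trans (cong toℕ πYw₂≡1+k) (FP.toℕ-fromℕ (suc k))

    column : G a w₁ ≡ (toℕ (πX ⟨$⟩ʳ a) <ᵇ 2)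
    column with a FP.≟ u₁ | a FP.≟ u₂
    ... | yes a≡u₁ | _        rewrite a≡u₁ | πXu₁≡0 = Equivalence.to T-≡ holds₁
    ... | no _     | yes a≡u₂ rewrite a≡u₂ | πXu₂≡1 = Equivalence.to T-≡ holds₂
    ... | no a≢u₁  | no a≢u₂  = trans (Equivalence.to T-not-≡ not-adjacent) (sym (high (πX ⟨$⟩ʳ a) πXa≢0 πXa≢1))
      where
      not-adjacent : T (not (G a w₁))
      not-adjacent with G a w₁ in e
      ... | false = tt
      ... | true  with only a (subst T (sym e) tt)
      ...   | inj₁ a≡u₁ = ⊥-elim (a≢u₁ a≡u₁)
      ...   | inj₂ a≡u₂ = ⊥-elim (a≢u₂ a≡u₂)
      πXa≢0 : πX ⟨$⟩ʳ a ≢ F.zero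
      πXa≢0 e = a≢u₁ (⟨$⟩ʳ-injective πX (trans e (sym πXu₁≡0)))
      πXa≢1 : πX ⟨$⟩ʳ a ≢ F.suc F.zero
      πXa≢1 e = a≢u₂ (⟨$⟩ʳ-injective πX (trans e (sym πXu₂≡1)))
      high : (c : Fin (suc (suc k))) → c ≢ F.zero → c ≢ F.suc F.zero → (toℕ c <ᵇ 2) ≡ false
      high F.zero            c≢0 _   = ⊥-elim (c≢0 refl)
      high (F.suc F.zero)    _   c≢1 = ⊥-elim (c≢1 refl)
      high (F.suc (F.suc c)) _   _   = refl

    by-cases : Dec (b ≡ w₁) → Dec (b ≡ w₂) → G a b ≡ Kplus4e (suc (suc k)) (πX ⟨$⟩ʳ a) (πY ⟨$⟩ʳ b)
    by-cases (yes refl) _ =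
      trans column (sym (Kplus4e-special _ _ (≤-reflexive (sym toℕ-πYw₁))))
    by-cases (no _) (yes refl) =
      trans (N[w₂]≡N[w₁] a) (trans column (sym (Kplus4e-special _ _ (≤-trans (n≤1+n k) (≤-reflexive (sym toℕ-πYw₂))))))
    by-cases (no b≢w₁) (no b≢w₂) = trans (complete a b b≢w₁ b≢w₂) (sym (Kplus4e-full _ _ y<k))
      where
      y = πY ⟨$⟩ʳ b
      y≢k : toℕ y ≢ k
      y≢k e = b≢w₁ (⟨$⟩ʳ-injective πY (FP.toℕ-injective (trans e (sym toℕ-πYw₁))))
      y≢1+k : toℕ y ≢ suc k
      y≢1+k e = b≢w₂ (⟨$⟩ʳ-injective πY (FP.toℕ-injective (trans e (sym toℕ-πYw₂))))
      y<k : toℕ y < k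
      y<k = ≤∧≢⇒< (≤-pred (≤∧≢⇒< (≤-pred (FP.toℕ<n y)) y≢1+k)) y≢k

  Kplus4eShape⇒≅ : G ≅ Kplus4e (suc (suc k))
  Kplus4eShape⇒≅
    with twoPointPermutation {b₁ = F.zero} {b₂ = F.suc F.zero} distinct (λ ())
       | twoPointPermutation {b₁ = inject₁ (fromℕ k)} {b₂ = fromℕ (suc k)} w₁≢w₂ (FP.fromℕ≢inject₁ ∘ sym)
  ... | πX , πXu₁≡0 , πXu₂≡1 | πY , πYw₁≡k , πYw₂≡1+k =
    relabel-≅ πX πY (Kplus4eShape-relabel πX πY πXu₁≡0 πXu₂≡1 πYw₁≡k πYw₂≡1+k)

Exceptional⇒≅Kplus4e : ∀ {k} (G : BipGraph (suc (suc k))) → Exceptional G → G ≅ Kplus4e (suc (suc k))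
Exceptional⇒≅Kplus4e G (inj₁ shape) = Kplus4eShape⇒≅ shape
Exceptional⇒≅Kplus4e G (inj₂ shape) = ≅-trans (≅-ᵀ G) (Kplus4eShape⇒≅ shape)

-- Closed graphs

Closed : BipGraph n → Set
Closed {n} G = ∀ x y → G x y ≡ false → n ≤ coDegX G x + coDegY G y

Closed-ᵀ : Closed G → Closed (G ᵀ)
Closed-ᵀ {n} {G} closed x y Gyx≡false = subst (n ≤_) (+-comm (coDegX G y) (coDegY G x)) (closed y x Gyx≡false)

MinDeg≥2-ᵀ : MinDeg≥2 G → MinDeg≥2 (G ᵀ)
MinDeg≥2-ᵀ (δX , δY) = δY , δX

coDegX+2≤n : (G : BipGraph n) → MinDeg≥2 G → ∀ x → coDegX G x + 2 ≤ n
coDegX+2≤n {n} G (δX , _) x = begin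
  coDegX G x + 2          ≤⟨ +-monoʳ-≤ (coDegX G x) (δX x) ⟩
  coDegX G x + degX G x   ≡⟨ +-comm (coDegX G x) (degX G x) ⟩
  degX G x + coDegX G x   ≡⟨ degX+coDegX≡n G x ⟩
  n                       ∎
  where open ≤-Reasoning

argmin-positive : (f : Fin n → ℕ) (a : Fin n) → 1 ≤ f a →
                  Σ (Fin n) λ v → 1 ≤ f v × (∀ u → 1 ≤ f u → f v ≤ f u)
argmin-positive f a fa>0 = go (f a) a ≤-refl fa>0
  where
  go : ∀ bound a → f a ≤ bound → 1 ≤ f a → Σ _ λ v → 1 ≤ f v × (∀ u → 1 ≤ f u → f v ≤ f u)
  go zero        a fa≤0 fa>0 = ⊥-elim (<⇒≱ fa>0 fa≤0)
  go (suc bound) a fa≤b fa>0 with FP.any? (λ u → (1 ≤? f u) ×-dec (f u <? f a))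
  ... | yes (u , fu>0 , fu<fa) = go bound u (≤-pred (≤-trans fu<fa fa≤b)) fu>0
  ... | no  ∄smaller          = a , fa>0 , λ u fu>0 → ≮⇒≥ (λ fu<fa → ∄smaller (u , fu>0 , fu<fa))

2*[c+d]≤d*c+3 : ∀ {c d} → 3 ≤ d → d ≤ c → 2 * (c + d) ≤ d * c + 3
2*[c+d]≤d*c+3 {c} {suc (suc (suc e))} (s≤s (s≤s (s≤s _))) d≤c = begin
  2 * (c + (3 + e))      ≡⟨ lhs c e ⟩
  c + c + 3 + (3 + e + e) ≤⟨ +-monoʳ-≤ (c + c + 3) (+-mono-≤ d≤c e≤e*c) ⟩
  c + c + 3 + (c + e * c) ≡⟨ rhs c e ⟩
  (3 + e) * c + 3        ∎
  where
  open ≤-Reasoning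
  e≤e*c : e ≤ e * c
  e≤e*c = ≤-trans (≤-reflexive (sym (*-identityʳ e))) (*-monoʳ-≤ e (≤-trans (s≤s z≤n) d≤c))
  lhs : ∀ c e → 2 * (c + (3 + e)) ≡ c + c + 3 + (3 + e + e)
  lhs = solve-∀
  rhs : ∀ c e → c + c + 3 + (c + e * c) ≡ (3 + e) * c + 3
  rhs = solve-∀

only-nonNeighbour⇒coDegX≤1 : (G : BipGraph n) (a w : Fin n) → (∀ b → b ≢ w → G a b ≡ true) → coDegX G a ≤ 1
only-nonNeighbour⇒coDegX≤1 G a w adjacent = countF≤1 (λ b → not (G a b)) w only-w
  where
  only-w : ∀ b → T (not (G a b)) → b ≡ w
  only-w b ¬Gab with b FP.≟ w
  ... | yes b≡w = b≡w
  ... | no  b≢w = ⊥-elim (subst (T ∘ not) (adjacent b b≢w) ¬Gab)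

equalColumns : (G : BipGraph n) → (∀ a y → G a y ≡ false → 2 ≤ coDegX G a) →
               ∀ {w₁ w₂} → (∀ a b → b ≢ w₁ → b ≢ w₂ → G a b ≡ true) → ∀ a → G a w₂ ≡ G a w₁
equalColumns G rows≥2 {w₁} {w₂} complete a with G a w₁ in e₁ | G a w₂ in e₂
... | true  | true  = refl
... | false | false = refl
... | true  | false = ⊥-elim (<⇒≱ (rows≥2 a w₂ e₂) (only-nonNeighbour⇒coDegX≤1 G a w₂ adjacent))
  where
  adjacent : ∀ b → b ≢ w₂ → G a b ≡ true
  adjacent b b≢w₂ with b FP.≟ w₁
  ... | yes refl = e₁
  ... | no  b≢w₁ = complete a b b≢w₁ b≢w₂
... | false | true  = ⊥-elim (<⇒≱ (rows≥2 a w₁ e₁) (only-nonNeighbour⇒coDegX≤1 G a w₁ adjacent))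
  where
  adjacent : ∀ b → b ≢ w₁ → G a b ≡ true
  adjacent b b≢w₁ with b FP.≟ w₂
  ... | yes refl = e₂
  ... | no  b≢w₂ = complete a b b≢w₁ b≢w₂

twoDegree2Columns⇒Kplus4eShape : (G : BipGraph n) → nonEdges G + 4 ≤ 2 * n →
  (∀ a y → G a y ≡ false → 2 ≤ coDegX G a) →
  ∀ {w₁ w₂} → w₁ ≢ w₂ → coDegY G w₁ + 2 ≡ n → coDegY G w₂ + 2 ≡ n →
  Kplus4eShape G × 2 * n ≤ nonEdges G + 4
twoDegree2Columns⇒Kplus4eShape {n} G nonEdges≤ rows≥2 {w₁} {w₂} w₁≢w₂ h₁+2≡n h₂+2≡n =
  record { u₁ = u₁ ; u₂ = u₂ ; w₁ = w₁ ; w₂ = w₂ ; w₁≢w₂ = w₁≢w₂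
         ; N[w₁]≡u₁u₂ = N[w₁] ; N[w₂]≡N[w₁] = equalColumns G rows≥2 complete ; complete = complete }
  , 2n≤nonEdges+4
  where
  h = coDegY G
  nonEdges≡∑h : nonEdges G ≡ sumF h
  nonEdges≡∑h = sym (nonEdges-ᵀ G)
  2n≡h₁+h₂+4 : 2 * n ≡ h w₁ + h w₂ + 4
  2n≡h₁+h₂+4 = trans (cong₂ (λ a b → a + (b + 0)) (sym h₁+2≡n) (sym h₂+2≡n)) (reshape (h w₁) (h w₂))
    where
    reshape : ∀ a b → a + 2 + (b + 2 + 0) ≡ a + b + 4
    reshape = solve-∀
  2n≤nonEdges+4 : 2 * n ≤ nonEdges G + 4
  2n≤nonEdges+4 = subst (_≤ nonEdges G + 4) (sym 2n≡h₁+h₂+4)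
    (+-monoˡ-≤ 4 (subst (h w₁ + h w₂ ≤_) (sym nonEdges≡∑h) (≤-sumF₂ h w₁≢w₂)))
  column-full : ∀ b → b ≢ w₁ → b ≢ w₂ → h b ≡ 0
  column-full b b≢w₁ b≢w₂ = n≤0⇒n≡0 (+-cancelˡ-≤ (h w₁ + h w₂) (h b) 0 (+-cancelʳ-≤ 4 _ _ (begin
    h w₁ + h w₂ + h b + 4  ≤⟨ +-monoˡ-≤ 4 (≤-sumF₃ h (w₁≢w₂) (b≢w₁ ∘ sym) (b≢w₂ ∘ sym)) ⟩
    sumF h + 4             ≡⟨ cong (_+ 4) nonEdges≡∑h ⟨
    nonEdges G + 4         ≤⟨ nonEdges≤ ⟩
    2 * n                  ≡⟨ 2n≡h₁+h₂+4 ⟩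
    h w₁ + h w₂ + 4        ≡⟨ cong (_+ 4) (+-identityʳ (h w₁ + h w₂)) ⟨
    h w₁ + h w₂ + 0 + 4    ∎)))
    where open ≤-Reasoning
  complete : ∀ a b → b ≢ w₁ → b ≢ w₂ → G a b ≡ true
  complete a b b≢w₁ b≢w₂ = not-injective (countF≡0⇒≡false (λ x → not (G x b)) (column-full b b≢w₁ b≢w₂) a)
  degY≡2 : degY G w₁ ≡ 2
  degY≡2 = +-cancelʳ-≡ (h w₁) _ _ (trans (degX+coDegX≡n (G ᵀ) w₁) (trans (sym h₁+2≡n) (+-comm (h w₁) 2)))
  N[w₁]-pair = countF≡2⇒ExactlyAt₂ (λ a → G a w₁) degY≡2
  u₁ = proj₁ N[w₁]-pair
  u₂ = proj₁ (proj₂ N[w₁]-pair)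
  N[w₁] = proj₂ (proj₂ N[w₁]-pair)

minimalRow⇒Kplus4eShape : (G : BipGraph n) → MinDeg≥2 G → nonEdges G + 4 ≤ 2 * n → Closed G →
  (v : Fin n) → 1 ≤ coDegX G v →
  (∀ x → 1 ≤ coDegX G x → coDegX G v ≤ coDegX G x) → (∀ y → 1 ≤ coDegY G y → coDegX G v ≤ coDegY G y) →
  Kplus4eShape G × 2 * n ≤ nonEdges G + 4
minimalRow⇒Kplus4eShape {n} G δ≥2 nonEdges≤ closed v d>0 minX minY = by-degree d refl
  where
  d = coDegX G v
  nonNbr : Fin n → Bool
  nonNbr y = not (G v y)
  v≁y : ∀ {y} → T (nonNbr y) → G v y ≡ false
  v≁y = Equivalence.to T-not-≡
  d≤coDegY : ∀ y → T (nonNbr y) → d ≤ coDegY G y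
  d≤coDegY y ¬vy = minY y (nonEdge⇒coDegX>0 (G ᵀ) y v (v≁y ¬vy))
  n≤d+coDegY : ∀ y → T (nonNbr y) → n ≤ d + coDegY G y
  n≤d+coDegY y ¬vy = closed v y (v≁y ¬vy)
  coDegY+2≤n : ∀ y → coDegY G y + 2 ≤ n
  coDegY+2≤n = coDegX+2≤n (G ᵀ) (MinDeg≥2-ᵀ δ≥2)

  -- Every non-neighbour of v has co-degree at least max(d, n - d).
  d≥3-impossible : 3 ≤ d → ⊥
  d≥3-impossible d≥3 = n≮n (2 * n) (begin-strict
    2 * n               ≤⟨ *-monoʳ-≤ 2 n≤c+d ⟩
    2 * (c + d)         ≤⟨ 2*[c+d]≤d*c+3 d≥3 (m≤m⊔n d (n ∸ d)) ⟩
    d * c + 3           <⟨ +-monoʳ-< (d * c) (n<1+n 3) ⟩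
    d * c + 4           ≤⟨ +-monoˡ-≤ 4 d*c≤nonEdges ⟩
    nonEdges G + 4      ≤⟨ nonEdges≤ ⟩
    2 * n               ∎)
    where
    open ≤-Reasoning
    c = d ⊔ (n ∸ d)
    n≤c+d : n ≤ c + d
    n≤c+d = ≤-trans (m≤n+m∸n n d) (≤-trans (+-monoʳ-≤ d (m≤n⊔m d (n ∸ d))) (≤-reflexive (+-comm d c)))
    d*c≤nonEdges : d * c ≤ nonEdges G
    d*c≤nonEdges = subst (d * c ≤_) (nonEdges-ᵀ G) (countF-*-≤ nonNbr (coDegY G) c
      (λ y ¬vy → ⊔-lub (d≤coDegY y ¬vy) (m≤n+o⇒m∸n≤o n d (n≤d+coDegY y ¬vy))))

  by-degree : ∀ k → d ≡ k → Kplus4eShape G × 2 * n ≤ nonEdges G + 4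
  by-degree zero d≡0 = ⊥-elim (<⇒≱ d>0 (≤-reflexive d≡0))
  by-degree (suc zero) d≡1 with countF>0⇒∃ nonNbr d>0
  ... | y , ¬vy = ⊥-elim (n≮n 1 (subst (2 ≤_) d≡1 (+-cancelʳ-≤ (coDegY G y) 2 d (begin
    2 + coDegY G y   ≡⟨ +-comm 2 (coDegY G y) ⟩
    coDegY G y + 2   ≤⟨ coDegY+2≤n y ⟩
    n                ≤⟨ n≤d+coDegY y ¬vy ⟩
    d + coDegY G y   ∎))))
    where open ≤-Reasoning
  by-degree (suc (suc zero)) d≡2 with countF≡2⇒ExactlyAt₂ nonNbr d≡2
  ... | w₁ , w₂ , ¬v[w₁w₂] =
    twoDegree2Columns⇒Kplus4eShape G nonEdges≤ rows≥2 distinct (column w₁ holds₁) (column w₂ holds₂)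
    where
    open ExactlyAt₂ ¬v[w₁w₂]
    rows≥2 : ∀ a y → G a y ≡ false → 2 ≤ coDegX G a
    rows≥2 a y Gay≡false = subst (_≤ coDegX G a) d≡2 (minX a (nonEdge⇒coDegX>0 G a y Gay≡false))
    column : ∀ w → T (nonNbr w) → coDegY G w + 2 ≡ n
    column w ¬vw = ≤-antisym (coDegY+2≤n w)
      (≤-trans (n≤d+coDegY w ¬vw) (≤-reflexive (trans (cong (_+ coDegY G w) d≡2) (+-comm 2 (coDegY G w)))))
  by-degree (suc (suc (suc k))) d≡3+k = ⊥-elim (d≥3-impossible (subst (3 ≤_) (sym d≡3+k) (s≤s (s≤s (s≤s z≤n)))))

Closed⇒Exceptional : (G : BipGraph n) → MinDeg≥2 G → nonEdges G + 4 ≤ 2 * n → Closed G → 1 ≤ nonEdges G →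
                     Exceptional G × 2 * n ≤ nonEdges G + 4
Closed⇒Exceptional {n} G δ≥2 nonEdges≤ closed nonEdges>0
  with sumF>0⇒∃>0 (coDegX G) nonEdges>0
... | x₀ , x₀>0 with countF>0⇒∃ (λ y → not (G x₀ y)) x₀>0
... | y₀ , ¬x₀y₀ with argmin-positive (coDegX G) x₀ x₀>0
                    | argmin-positive (coDegY G) y₀ (nonEdge⇒coDegX>0 (G ᵀ) y₀ x₀ (Equivalence.to T-not-≡ ¬x₀y₀))
... | vx , vx>0 , minX | vy , vy>0 , minY with coDegX G vx ≤? coDegY G vy
...   | yes X≤Y = Product.map₁ inj₁
  (minimalRow⇒Kplus4eShape G δ≥2 nonEdges≤ closed vx vx>0 minX (λ y y>0 → ≤-trans X≤Y (minY y y>0)))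
...   | no  X≰Y = Product.map inj₂ (subst (λ e → 2 * n ≤ e + 4) (nonEdges-ᵀ G))
  (minimalRow⇒Kplus4eShape (G ᵀ) (MinDeg≥2-ᵀ δ≥2) (subst (λ e → e + 4 ≤ 2 * n) (sym (nonEdges-ᵀ G)) nonEdges≤)
    (Closed-ᵀ closed) vy vy>0 minY (λ x x>0 → ≤-trans (<⇒≤ (≰⇒> X≰Y)) (minX x x>0)))

nonEdges≡0⇒HamCycle : (G : BipGraph (suc m)) → nonEdges G ≡ 0 → HamCycle G
nonEdges≡0⇒HamCycle G nonEdges≡0 =
  Perm.id , Perm.id , record { rung = λ i → adjacent i i ; step = λ i → adjacent (next i) i }
  where
  adjacent : ∀ a b → T (G a b)
  adjacent a b = Equivalence.from T-≡
    (not-injective (countF≡0⇒≡false (λ y → not (G a y)) (sumF≡0⇒≡0 (coDegX G) nonEdges≡0 a) b))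

HamCycle⊎Exceptional : ∀ k (G : BipGraph (suc (suc m))) → nonEdges G ≡ k → MinDeg≥2 G → k + 4 ≤ 2 * suc (suc m) →
                       HamCycle G ⊎ (Exceptional G × 2 * suc (suc m) ≤ k + 4)
HamCycle⊎Exceptional zero G nonEdges≡0 _ _ = inj₁ (nonEdges≡0⇒HamCycle G nonEdges≡0)
HamCycle⊎Exceptional {m} (suc k) G nonEdges≡1+k δ≥2 1+k+4≤2n =
  by-closability (FP.any? (λ x → FP.any? (λ y → (G x y Bool.≟ false) ×-dec (suc N ≤? degX G x + degY G y))))
  where
  N = suc (suc m)
  Closable : Set
  Closable = Σ (Fin N) λ x → Σ (Fin N) λ y → G x y ≡ false × suc N ≤ degX G x + degY G y

  closed : ¬ Closable → Closed G
  closed ∄closable x y Gxy≡false = +-cancelˡ-≤ N N _ (begin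
    N + N                                              ≡⟨ cong₂ _+_ (degX+coDegX≡n G x) (degX+coDegX≡n (G ᵀ) y) ⟨
    (degX G x + coDegX G x) + (degY G y + coDegY G y)  ≡⟨ interchange (degX G x) (coDegX G x) (degY G y) (coDegY G y) ⟩
    (degX G x + degY G y) + (coDegX G x + coDegY G y)  ≤⟨ +-monoˡ-≤ _ (≮⇒≥ λ N<deg → ∄closable (x , y , Gxy≡false , N<deg)) ⟩
    N + (coDegX G x + coDegY G y)                      ∎)
    where open ≤-Reasoning

  by-closability : Dec Closable → HamCycle G ⊎ (Exceptional G × 2 * N ≤ suc k + 4)
  by-closability (yes (x , y , Gxy≡false , deg-sum))
    with HamCycle⊎Exceptional k (addEdge G x y)
           (suc-injective (trans (sym (nonEdges-addEdge G x y Gxy≡false)) nonEdges≡1+k))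
           (MinDeg≥2-mono (⊆-addEdge G x y) δ≥2) (≤-trans (n≤1+n (k + 4)) 1+k+4≤2n)
  ... | inj₁ cycle′       = inj₁ (HamCycle-removeEdge G (addEdge G x y) x y (addEdge-⊆∪ G x y) deg-sum cycle′)
  ... | inj₂ (_ , 2N≤k+4) = ⊥-elim (<⇒≱ 1+k+4≤2n 2N≤k+4)
  by-closability (no ∄closable) = inj₂ (subst (λ e → Exceptional G × 2 * N ≤ e + 4) nonEdges≡1+k
    (Closed⇒Exceptional G δ≥2 (subst (λ e → e + 4 ≤ 2 * N) (sym nonEdges≡1+k) 1+k+4≤2n) (closed ∄closable)
      (subst (1 ≤_) (sym nonEdges≡1+k) (s≤s z≤n))))

lemma4 : (n : ℕ) → 4 ≤ n → (G : BipGraph n) → MinDeg≥2 G →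
    n * n + 4 ≤ edges G + 2 * n →
    ¬ (G ≅ Kplus4e n) → Hamiltonian G
lemma4 n@(suc (suc _)) (s≤s (s≤s _)) G δ≥2 dense G≇K =
  [ HamCycle⇒Hamiltonian G , (λ (exceptional , _) → ⊥-elim (G≇K (Exceptional⇒≅Kplus4e G exceptional))) ]′
  (HamCycle⊎Exceptional (nonEdges G) G refl δ≥2 sparse)
  where
  sparse : nonEdges G + 4 ≤ 2 * n
  sparse = +-cancelˡ-≤ (edges G) _ _ (begin
    edges G + (nonEdges G + 4)  ≡⟨ +-assoc (edges G) (nonEdges G) 4 ⟨
    edges G + nonEdges G + 4    ≡⟨ cong (_+ 4) (edges+nonEdges≡n*n G) ⟩
    n * n + 4                   ≤⟨ dense ⟩
    edges G + 2 * n             ∎)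
    where open ≤-Reasoning
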